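{- Let $\mathcal{C}$ be any nice clustering for a facility location instance $(F,D)$. Then the solution defined by $\mathcal{C}$ (open exactly the facilities $i$ with $\mathcal{C}(i)\neq\emptyset$ and assign each client to the facility of the unique cluster of $\mathcal{C}$ containing it) has cost at most $O(1)$ times the optimum cost of the instance, where the $O(1)$ is an absolute constant.
   Context: Facility location: finite facility set $F$, finite client set $D$, in a common metric space; $d_{ij}>0$ is the distance between facility $i$ and client $j$ (triangle inequality holds), $f_i\ge0$ the opening cost of facility $i$. A solution opens $F'\subseteq F$ and assigns each client $j$ to an open facility $i_j$; its cost is $\sum_{i\in F'} f_i+\sum_{j\in D}d_{i_j j}$. Clusters: a cluster is a pair $C=(i,A)$ with $i\in F$, $A\subseteq D$, designated either critical or satellite; satellite clusters have exactly one client. $cost(C)=\sum_{j\in A}d_{ij}$ if $C$ is satellite and $cost(C)=f_i+\sum_{j\in A}d_{ij}$ if critical; $cost_{avg}(C)=cost(C)/|A|$. A clustering is a collection $\mathcal{C}$ of clusters such that every client of $D$ belongs to exactly one cluster of $\mathcal{C}$, and for each facility $i$, if the set $\mathcal{C}(i)$ of clusters of $\mathcal{C}$ with facility $i$ is nonempty then exactly one cluster of $\mathcal{C}(i)$ is critical. Every cluster $C\in\mathcal{C}$ has an integer level $\ell(C)\in\mathbb{Z}$, and for a client $j$ in $C$ we put $\ell(j)=\ell(C)$. For $i\in F,j\in D$, $\kappa^*_{ij}$ is the unique integer with $2^{\kappa^*_{ij}-4}\le d_{ij}<2^{\kappa^*_{ij}-3}$. Blocking cluster: a cluster $C=(i,A)$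 (not necessarily in $\mathcal{C}$) is blocking at level $k\in\mathbb{Z}$ w.r.t. $\mathcal{C}$ if (a) $cost_{avg}(C)<2^{k-3}$; (b) for every $j\in A$, $\ell(j)>k\ge\kappa^*_{ij}$; (c) if $C$ is satellite, there is a critical cluster $C^*\in\mathcal{C}(i)$ with $\ell(C^*)\le k$, and if $C$ is critical, then $k\le\ell(C')$ for all $C'\in\mathcal{C}(i)$. Nice clustering: $\mathcal{C}$ is nice if (I1) $cost_{avg}(C)<2^{\ell(C)}$ for all $C\in\mathcal{C}$; (I2) for each facility $i$ with $\mathcal{C}(i)\ne\emptyset$, the critical cluster $C^*\in\mathcal{C}(i)$ satisfies $\ell(C^*)\le\ell(C)$ for all $C\in\mathcal{C}(i)$; (I3) for every $C=(i,A)\in\mathcal{C}$ and $j\in A$, $\ell(j)\ge\kappa^*_{ij}$; (I4) there is no blocking cluster w.r.t. $\mathcal{C}$ at any level $k\in\mathbb{Z}$.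
   Formalization: The distances $d_{ij}$ and the opening costs $f_i$ of each instance take rational values. -}

module Defs where

open import Data.Bool using (Bool; true; false; if_then_else_; _∨_)
open import Data.Nat as ℕ using (ℕ; zero; suc)
open import Data.Nat.Properties using (m^n≢0)
open import Data.Integer as ℤ using (ℤ; +_; -[1+_])
open import Data.Fin using (Fin; _≟_)
open import Data.Rational using (ℚ; _/_; 0ℚ; 1ℚ; _+_; _*_; _≤_; _<_)
open import Data.Product using (Σ; ∃; _×_)
open import Relation.Binary.PropositionalEquality using (_≡_)
open import Relation.Nullary using (¬_)
open import Relation.Nullary.Decidable using (⌊_⌋)

pow2 : ℤ → ℚ
pow2 (+ n) = + (2 ℕ.^ n) / 1
pow2 -[1+ n ] = _/_ (+ 1) (2 ℕ.^ suc n) {{m^n≢0 2 (suc n)}}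

ℕtoℚ : ℕ → ℚ
ℕtoℚ n = + n / 1

sumF : ∀ n → (Fin n → ℚ) → ℚ
sumF zero g = 0ℚ
sumF (suc n) g = g Data.Fin.zero + sumF n (λ k → g (Data.Fin.suc k))

countF : ∀ n → (Fin n → Bool) → ℕ
countF zero g = 0
countF (suc n) g = (if g Data.Fin.zero then 1 else 0) ℕ.+ countF n (λ k → g (Data.Fin.suc k))

anyF : ∀ n → (Fin n → Bool) → Bool
anyF zero g = false
anyF (suc n) g = g Data.Fin.zero ∨ anyF n (λ k → g (Data.Fin.suc k))

record Instance : Set where
  field
    nF nD : ℕ
    d : Fin nF → Fin nD → ℚ
    f : Fin nF → ℚ

module _ (I : Instance) where
  open Instance I

  -- d_ij > 0, f_i ≥ 0, and the triangle inequality of the common metric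
  -- restricted to facility/client distances.
  ValidInstance : Set
  ValidInstance =
    (∀ i j → 0ℚ < d i j) ×
    (∀ i → 0ℚ ≤ f i) ×
    (∀ i i' j j' → d i j ≤ (d i j' + d i' j') + d i' j)

  IsSolution : (Fin nF → Bool) → (Fin nD → Fin nF) → Set
  IsSolution op σ = ∀ j → op (σ j) ≡ true

  solCost : (Fin nF → Bool) → (Fin nD → Fin nF) → ℚ
  solCost op σ = sumF nF (λ i → if op i then f i else 0ℚ) + sumF nD (λ j → d (σ j) j)

  IsKappa : Fin nF → Fin nD → ℤ → Set
  IsKappa i j k = (pow2 (k ℤ.- + 4) ≤ d i j) × (d i j < pow2 (k ℤ.- + 3))

  -- A cluster (i, A) with a critical/satellite flag (true = critical);
  -- A ⊆ D given by its characteristic function.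
  record Cluster : Set where
    constructor cluster
    field
      fac  : Fin nF
      crit : Bool
      mem  : Fin nD → Bool

  size : Cluster → ℕ
  size C = countF nD (Cluster.mem C)

  cost : Cluster → ℚ
  cost C = (if crit then f fac else 0ℚ) + sumF nD (λ j → if mem j then d fac j else 0ℚ)
    where open Cluster C

  -- cost_avg(C) < x, i.e. cost(C)/|A| < x, written as cost(C) < |A| * x (|A| > 0)
  AvgLt : Cluster → ℚ → Set
  AvgLt C x = cost C < ℕtoℚ (size C) * x

  ValidCluster : Cluster → Set
  ValidCluster C = (∃ λ j → Cluster.mem C j ≡ true) ×
                   (Cluster.crit C ≡ false → size C ≡ 1)

  record Clustering : Set where
    field
      m   : ℕ
      fac : Fin m → Fin nF
      crit : Fin m → Bool
      lev : Fin m → ℤ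
      clu : Fin nD → Fin m

  module _ (𝒞 : Clustering) where
    open Clustering 𝒞

    clusterOf : Fin m → Cluster
    clusterOf c = cluster (fac c) (crit c) (λ j → ⌊ clu j ≟ c ⌋)

    levelOf : Fin nD → ℤ
    levelOf j = lev (clu j)

    -- each cluster is well formed (each client lies in exactly one cluster by
    -- construction), and each facility with C(i) ≠ ∅ has exactly one critical cluster
    IsClustering : Set
    IsClustering =
      (∀ c → ValidCluster (clusterOf c)) ×
      (∀ c → Σ (Fin m) λ c* → (fac c* ≡ fac c) × (crit c* ≡ true) ×
               (∀ c' → fac c' ≡ fac c → crit c' ≡ true → c' ≡ c*))

    openOf : Fin nF → Bool
    openOf i = anyF m (λ c → ⌊ fac c ≟ i ⌋)

    assignOf : Fin nD → Fin nF
    assignOf j = fac (clu j)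

    Blocking : Cluster → ℤ → Set
    Blocking C k =
      ValidCluster C ×
      AvgLt C (pow2 (k ℤ.- + 3)) ×
      (∀ j → Cluster.mem C j ≡ true →
         (k ℤ.< levelOf j) × (∀ κ → IsKappa (Cluster.fac C) j κ → κ ℤ.≤ k)) ×
      (if Cluster.crit C
         then (∀ c' → fac c' ≡ Cluster.fac C → k ℤ.≤ lev c')
         else (∃ λ c* → (fac c* ≡ Cluster.fac C) × (crit c* ≡ true) × (lev c* ℤ.≤ k)))

    Nice : Set
    Nice =
      (∀ c → AvgLt (clusterOf c) (pow2 (lev c))) ×
      (∀ c c* → fac c* ≡ fac c → crit c* ≡ true → lev c* ℤ.≤ lev c) ×
      (∀ c j → clu j ≡ c → ∀ κ → IsKappa (fac c) j κ → κ ℤ.≤ lev c) ×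
      (∀ (C : Cluster) (k : ℤ) → ¬ Blocking C k)

-- Summing (I1) over the clusters bounds the cost of the solution defined by 𝒞 by Σⱼ 2^ℓ(j);
-- this sum is then charged to an arbitrary solution, one star (a facility i and the clients S
-- it serves) at a time. A non-blocking singleton satellite shows that a facility hosting a
-- cluster of level < ℓ(j) is at distance ≥ 2^(ℓ(j)-4) from j. With (I3) and the triangle
-- inequality, two clients whose levels differ by at least 2 are then at total distance
-- > 2^(L-5) from any facility, L the larger level. Let j₀ ∈ S be nearest to i and M = ℓ(j₀).
-- Every j ∈ S with |ℓ(j) - M| ≥ 2, or with d(i,j) ≥ 2^(M-6), pays for itself:
-- 2^ℓ(j) ≤ 2^7 d(i,j); so does every j ∈ S if some cluster at i has level < M - 2. Otherwise the
-- remaining clients form a critical cluster at level M - 2, and since it is not blocking their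
-- number is at most f_i / 2^(M-6). Altogether Σ_{j∈S} 2^ℓ(j) ≤ 2^7 (f_i + Σ_{j∈S} d(i,j)).
module Submission where

open import Defs
open import Algebra.Bundles using (CommutativeRing)
open import Data.Bool using (Bool; true; false; if_then_else_)
import Data.Bool as Bool
import Data.Bool.Properties as BoolP
open import Data.Empty using (⊥; ⊥-elim)
open import Data.Fin using (Fin; zero; suc; _≟_)
import Data.Fin.Properties as FinP
open import Data.Integer as ℤ using (ℤ; +_; -[1+_])
import Data.Integer.Properties as ℤP
open import Data.Integer.Tactic.RingSolver using (solve-∀; solve)
open import Data.List using ([]; _∷_)
open import Data.Nat as ℕ using (ℕ; zero; suc)
import Data.Nat.Properties as ℕP
open import Data.Product using (∃; ∃-syntax; _×_; _,_; proj₁; proj₂)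
open import Data.Rational as ℚ using (ℚ; 0ℚ; 1ℚ; _+_; _*_; _≤_; _<_; _/_; toℚᵘ)
import Data.Rational.Properties as ℚP
open import Data.Rational.Unnormalised as ℚᵘ using (mkℚᵘ; *≡*; *<*)
import Data.Rational.Unnormalised.Properties as ℚᵘP
open import Data.Sum using (_⊎_; inj₁; inj₂)
open import Function using (_∘_)
open import Relation.Binary.PropositionalEquality
  using (_≡_; _≢_; refl; sym; trans; cong; cong₂; subst; subst₂; module ≡-Reasoning)
open import Relation.Nullary using (¬_; Dec; yes; no; contradiction; _×-dec_)
open import Relation.Nullary.Decidable using (⌊_⌋; ⌊⌋-map′)
open import Algebra.Properties.Semiring.Sum (CommutativeRing.semiring ℚP.+-*-commutativeRing)
  using (sum; ∑-comm; ∑-distrib-+; *-distribˡ-sum; sum-cong-≗; sum-replicate-zero)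

-- Rational and integer arithmetic

p≤p+q : ∀ {p q} → 0ℚ ≤ q → p ≤ p + q
p≤p+q {p} 0≤q = ℚP.≤-trans (ℚP.≤-reflexive (sym (ℚP.+-identityʳ p))) (ℚP.+-monoʳ-≤ p 0≤q)

q≤p+q : ∀ {p q} → 0ℚ ≤ p → q ≤ p + q
q≤p+q {p} {q} 0≤p = ℚP.≤-trans (ℚP.≤-reflexive (sym (ℚP.+-identityˡ q))) (ℚP.+-monoˡ-≤ q 0≤p)

*-nonneg : ∀ {p q} → 0ℚ ≤ p → 0ℚ ≤ q → 0ℚ ≤ p * q
*-nonneg {p} {q} 0≤p 0≤q =
  ℚP.nonNegative⁻¹ _ {{ℚP.nonNeg*nonNeg⇒nonNeg p {{ℚ.nonNegative 0≤p}} q {{ℚ.nonNegative 0≤q}}}}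

+-cancelˡ-< : ∀ {p q r} → p + q < p + r → q < r
+-cancelˡ-< {p} p+q<p+r = ℚP.≰⇒> λ r≤q → ℚP.<-irrefl refl (ℚP.<-≤-trans p+q<p+r (ℚP.+-monoʳ-≤ p r≤q))

p+p<q+q⇒p<q : ∀ {p q} → p + p < q + q → p < q
p+p<q+q⇒p<q p+p<q+q = ℚP.≰⇒> λ q≤p → ℚP.<-irrefl refl (ℚP.<-≤-trans p+p<q+q (ℚP.+-mono-≤ q≤p q≤p))

toℚᵘ-/ : ∀ i n .{{_ : ℕ.NonZero n}} → toℚᵘ (i / n) ℚᵘ.≃ (i ℚᵘ./ n)
toℚᵘ-/ i (suc n) = ℚP.toℚᵘ-fromℚᵘ (mkℚᵘ i n)

/-cong-≃ : ∀ {i j} m n .{{_ : ℕ.NonZero m}} .{{_ : ℕ.NonZero n}} →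
           (i ℚᵘ./ m) ℚᵘ.≃ (j ℚᵘ./ n) → i / m ≡ j / n
/-cong-≃ (suc m) (suc n) = ℚP.fromℚᵘ-cong

+ᵘ-/ : ∀ i j n .{{_ : ℕ.NonZero n}} → (i ℚᵘ./ n) ℚᵘ.+ (j ℚᵘ./ n) ℚᵘ.≃ ((i ℤ.+ j) ℚᵘ./ n)
+ᵘ-/ i j n@(suc _) = *≡* (begin
  (i ℤ.* + n ℤ.+ j ℤ.* + n) ℤ.* + n ≡⟨ distrib i j (+ n) ⟩
  (i ℤ.+ j) ℤ.* (+ n ℤ.* + n)       ≡⟨ cong ((i ℤ.+ j) ℤ.*_) (ℤP.pos-* n n) ⟨
  (i ℤ.+ j) ℤ.* + (n ℕ.* n)         ∎)
  where
  open ≡-Reasoning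
  distrib : ∀ a b c → (a ℤ.* c ℤ.+ b ℤ.* c) ℤ.* c ≡ (a ℤ.+ b) ℤ.* (c ℤ.* c)
  distrib = solve-∀

+-/ : ∀ i j n .{{_ : ℕ.NonZero n}} → i / n + j / n ≡ (i ℤ.+ j) / n
+-/ i j n = ℚP.toℚᵘ-injective (begin
  toℚᵘ (i / n + j / n)              ≈⟨ ℚP.toℚᵘ-homo-+ (i / n) (j / n) ⟩
  toℚᵘ (i / n) ℚᵘ.+ toℚᵘ (j / n)    ≈⟨ ℚᵘP.+-cong (toℚᵘ-/ i n) (toℚᵘ-/ j n) ⟩
  (i ℚᵘ./ n) ℚᵘ.+ (j ℚᵘ./ n)        ≈⟨ +ᵘ-/ i j n ⟩
  (i ℤ.+ j) ℚᵘ./ n                  ≈⟨ toℚᵘ-/ (i ℤ.+ j) n ⟨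
  toℚᵘ ((i ℤ.+ j) / n)              ∎)
  where open ℚᵘP.≃-Reasoning

ℕtoℚ-suc : ∀ n → ℕtoℚ (suc n) ≡ 1ℚ + ℕtoℚ n
ℕtoℚ-suc n = sym (+-/ (+ 1) (+ n) 1)

i<i+[1+n] : ∀ i n → i ℤ.< i ℤ.+ + suc n
i<i+[1+n] i n = subst (ℤ._< i ℤ.+ + suc n) (ℤP.+-identityʳ i) (ℤP.+-monoʳ-< i (ℤ.+<+ ℕ.z<s))

i≤+∣i∣ : ∀ i → i ℤ.≤ + ℤ.∣ i ∣
i≤+∣i∣ (+ n)    = ℤP.≤-refl
i≤+∣i∣ -[1+ n ] = ℤ.-≤+

a+2≤b⇒a-7≤b-6 : ∀ {a b} → a ℤ.+ + 2 ℤ.≤ b → a ℤ.- + 7 ℤ.≤ b ℤ.- + 6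
a+2≤b⇒a-7≤b-6 {a} {b} a+2≤b = begin
  a ℤ.- + 7               ≤⟨ ℤP.+-monoʳ-≤ a (ℤ.-≤- (ℕP.m≤m+n 3 3)) ⟩
  a ℤ.- + 4               ≡⟨ solve (a ∷ []) ⟩
  (a ℤ.+ + 2) ℤ.- + 6     ≤⟨ ℤP.+-monoˡ-≤ (ℤ.- + 6) a+2≤b ⟩
  b ℤ.- + 6               ∎
  where open ℤP.≤-Reasoning

a+2≰b⇒b-2<a : ∀ {a b} → ¬ (a ℤ.+ + 2 ℤ.≤ b) → b ℤ.- + 2 ℤ.< a
a+2≰b⇒b-2<a {a} {b} a+2≰b = begin-strict
  b ℤ.- + 2               <⟨ ℤP.+-monoˡ-< (ℤ.- + 2) (ℤP.≰⇒> a+2≰b) ⟩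
  (a ℤ.+ + 2) ℤ.- + 2     ≡⟨ solve (a ∷ []) ⟩
  a                       ∎
  where open ℤP.≤-Reasoning

a<b+2⇒a-7≤b-2-4 : ∀ {a b} → a ℤ.< b ℤ.+ + 2 → a ℤ.- + 7 ℤ.≤ (b ℤ.- + 2) ℤ.- + 4
a<b+2⇒a-7≤b-2-4 {a} {b} a<b+2 = begin
  a ℤ.- + 7                  ≡⟨ solve (a ∷ []) ⟩
  (+ 1 ℤ.+ a) ℤ.- + 8        ≤⟨ ℤP.+-monoˡ-≤ (ℤ.- + 8) (ℤP.i<j⇒suc[i]≤j a<b+2) ⟩
  (b ℤ.+ + 2) ℤ.- + 8        ≡⟨ solve (b ∷ []) ⟩
  (b ℤ.- + 2) ℤ.- + 4        ∎
  where open ℤP.≤-Reasoning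

n<2^n : ∀ n → n ℕ.< 2 ℕ.^ n
n<2^n zero    = ℕ.z<s
n<2^n (suc n) = ℕP.+-mono-≤-< (ℕP.m^n>0 2 n) (ℕP.<-≤-trans (n<2^n n) (ℕP.m≤m+n (2 ℕ.^ n) 0))

-- Powers of two

pow2-suc : ∀ a → pow2 (ℤ.suc a) ≡ pow2 a + pow2 a
pow2-suc (+ n) = begin
  + (2 ℕ.^ suc n) / 1           ≡⟨ cong (λ m → + (2 ℕ.^ n ℕ.+ m) / 1) (ℕP.+-identityʳ (2 ℕ.^ n)) ⟩
  + (2 ℕ.^ n ℕ.+ 2 ℕ.^ n) / 1   ≡⟨ +-/ (+ (2 ℕ.^ n)) (+ (2 ℕ.^ n)) 1 ⟨
  pow2 (+ n) + pow2 (+ n)       ∎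
  where open ≡-Reasoning
pow2-suc -[1+ zero ] = refl
pow2-suc -[1+ suc n ] = begin
  + 1 / 2^[n+1]                  ≡⟨ /-cong-≃ {+ 2} {+ 1} 2^[n+2] 2^[n+1] (ℚᵘP.*-cancelˡ-/ 2 {+ 1}) ⟨
  + 2 / 2^[n+2]                  ≡⟨ +-/ (+ 1) (+ 1) 2^[n+2] ⟨
  + 1 / 2^[n+2] + + 1 / 2^[n+2]  ∎
  where
  open ≡-Reasoning
  2^[n+1] = 2 ℕ.^ suc n
  2^[n+2] = 2 ℕ.^ suc (suc n)
  instance
    _ = ℕP.m^n≢0 2 (suc n)
    _ = ℕP.m^n≢0 2 (suc (suc n))

pow2-pos : ∀ a → 0ℚ < pow2 a
pow2-pos (+ n)    = ℚP.positive⁻¹ _ {{ℚP.normalize-pos (2 ℕ.^ n) 1 {{_}} {{ℕP.m^n≢0 2 n}}}}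
pow2-pos -[1+ n ] = ℚP.positive⁻¹ _ {{ℚP.normalize-pos 1 (2 ℕ.^ suc n) {{ℕP.m^n≢0 2 (suc n)}}}}

pow2-+ : ∀ k a → pow2 (+ k ℤ.+ a) ≡ pow2 (+ k) * pow2 a
pow2-+ zero a = trans (cong pow2 (ℤP.+-identityˡ a)) (sym (ℚP.*-identityˡ (pow2 a)))
pow2-+ (suc k) a = begin
  pow2 (+ suc k ℤ.+ a)                   ≡⟨ cong pow2 (ℤP.+-assoc (+ 1) (+ k) a) ⟩
  pow2 (ℤ.suc (+ k ℤ.+ a))               ≡⟨ pow2-suc (+ k ℤ.+ a) ⟩
  pow2 (+ k ℤ.+ a) + pow2 (+ k ℤ.+ a)    ≡⟨ cong₂ _+_ (pow2-+ k a) (pow2-+ k a) ⟩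
  pow2 (+ k) * pow2 a + pow2 (+ k) * pow2 a ≡⟨ ℚP.*-distribʳ-+ (pow2 a) (pow2 (+ k)) (pow2 (+ k)) ⟨
  (pow2 (+ k) + pow2 (+ k)) * pow2 a     ≡⟨ cong (_* pow2 a) (pow2-suc (+ k)) ⟨
  pow2 (+ suc k) * pow2 a                ∎
  where open ≡-Reasoning

pow2-split : ∀ n a → pow2 a ≡ pow2 (+ n) * pow2 (a ℤ.- + n)
pow2-split n a = trans (cong pow2 (sym (cancel (+ n) a))) (pow2-+ n (a ℤ.- + n))
  where
  cancel : ∀ x b → x ℤ.+ (b ℤ.- x) ≡ b
  cancel = solve-∀

pow2-≤-+ : ∀ k a → pow2 a ≤ pow2 (+ k ℤ.+ a)
pow2-≤-+ zero a = ℚP.≤-reflexive (cong pow2 (sym (ℤP.+-identityˡ a)))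
pow2-≤-+ (suc k) a = begin
  pow2 a                                 ≤⟨ pow2-≤-+ k a ⟩
  pow2 (+ k ℤ.+ a)                       ≤⟨ p≤p+q (ℚP.<⇒≤ (pow2-pos (+ k ℤ.+ a))) ⟩
  pow2 (+ k ℤ.+ a) + pow2 (+ k ℤ.+ a)    ≡⟨ pow2-suc (+ k ℤ.+ a) ⟨
  pow2 (ℤ.suc (+ k ℤ.+ a))               ≡⟨ cong pow2 (ℤP.+-assoc (+ 1) (+ k) a) ⟨
  pow2 (+ suc k ℤ.+ a)                   ∎
  where open ℚP.≤-Reasoning

pow2-mono-≤ : ∀ {a b} → a ℤ.≤ b → pow2 a ≤ pow2 b
pow2-mono-≤ {a} {b} a≤b = subst (λ c → pow2 a ≤ pow2 c) offset (pow2-≤-+ ℤ.∣ b ℤ.- a ∣ a)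
  where
  cancel : ∀ x y → (y ℤ.- x) ℤ.+ x ≡ y
  cancel = solve-∀
  offset : + ℤ.∣ b ℤ.- a ∣ ℤ.+ a ≡ b
  offset = trans (cong (ℤ._+ a) (ℤP.0≤i⇒+∣i∣≡i (ℤP.i≤j⇒0≤j-i a≤b))) (cancel a b)

pow2-minus-suc : ∀ a n → pow2 (a ℤ.- + suc n) + pow2 (a ℤ.- + suc n) ≡ pow2 (a ℤ.- + n)
pow2-minus-suc a n = begin
  pow2 (a ℤ.- + suc n) + pow2 (a ℤ.- + suc n) ≡⟨ pow2-suc (a ℤ.- + suc n) ⟨
  pow2 (ℤ.suc (a ℤ.- + suc n))                ≡⟨ cong (pow2 ∘ ℤ.suc) (ℤP.minus-suc a n) ⟩
  pow2 (ℤ.suc (ℤ.pred (a ℤ.- + n)))           ≡⟨ cong pow2 (ℤP.suc-pred (a ℤ.- + n)) ⟩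
  pow2 (a ℤ.- + n)                            ∎
  where open ≡-Reasoning

pow2-minus-antimono : ∀ a {m n} → m ℕ.≤ n → pow2 (a ℤ.- + n) ≤ pow2 (a ℤ.- + m)
pow2-minus-antimono a m≤n = pow2-mono-≤ (ℤP.+-monoʳ-≤ a (ℤP.neg-mono-≤ (ℤ.+≤+ m≤n)))

pow2-cancel-< : ∀ {a b} → pow2 a < pow2 b → a ℤ.< b
pow2-cancel-< p<q = ℤP.≰⇒> (λ b≤a → ℚP.<-irrefl refl (ℚP.<-≤-trans p<q (pow2-mono-≤ b≤a)))

pow2-unbounded : ∀ x → ∃[ n ] x < pow2 (+ n)
pow2-unbounded (ℚ.mkℚ (+ n) d-1 _) = n , ℚP.toℚᵘ-cancel-<
  (ℚᵘP.<-respʳ-≃ (ℚᵘP.≃-sym (toℚᵘ-/ (+ 2 ℕ.^ n) 1))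
    (*<* (subst₂ ℤ._<_ (ℤP.pos-* n 1) (ℤP.pos-* (2 ℕ.^ n) (suc d-1)) (ℤ.+<+ n*1<2^n*d))))
  where
  open ℕP.≤-Reasoning
  n*1<2^n*d : n ℕ.* 1 ℕ.< 2 ℕ.^ n ℕ.* suc d-1
  n*1<2^n*d = begin-strict
    n ℕ.* 1             ≡⟨ ℕP.*-identityʳ n ⟩
    n                   <⟨ n<2^n n ⟩
    2 ℕ.^ n             ≤⟨ ℕP.m≤m*n (2 ℕ.^ n) (suc d-1) ⟩
    2 ℕ.^ n ℕ.* suc d-1 ∎
pow2-unbounded (ℚ.mkℚ -[1+ n ] d-1 _) = 0 , ℚP.toℚᵘ-cancel-< (*<* ℤ.-<+)

pow2-bracket : ∀ {x a} → pow2 a ≤ x → ∃[ b ] pow2 b ≤ x × x < pow2 (ℤ.suc b)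
pow2-bracket {x} {a} 2^a≤x with pow2-unbounded x
... | m , x<2^m = search ℤ.∣ + m ℤ.- a ∣ a 2^a≤x (ℚP.<-≤-trans x<2^m (pow2-mono-≤ m≤N+a))
  where
  shift : ∀ n b → (+ 1 ℤ.+ n) ℤ.+ b ≡ n ℤ.+ (+ 1 ℤ.+ b)
  shift = solve-∀
  cancel : ∀ i b → i ≡ (i ℤ.- b) ℤ.+ b
  cancel = solve-∀
  m≤N+a : + m ℤ.≤ + ℤ.∣ + m ℤ.- a ∣ ℤ.+ a
  m≤N+a = ℤP.≤-trans (ℤP.≤-reflexive (cancel (+ m) a)) (ℤP.+-monoˡ-≤ a (i≤+∣i∣ (+ m ℤ.- a)))
  search : ∀ n b → pow2 b ≤ x → x < pow2 (+ n ℤ.+ b) → ∃[ b ] pow2 b ≤ x × x < pow2 (ℤ.suc b)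
  search zero    b 2^b≤x x<2^b = ⊥-elim (ℚP.<-irrefl refl
    (ℚP.≤-<-trans 2^b≤x (subst (λ c → x < pow2 c) (ℤP.+-identityˡ b) x<2^b)))
  search (suc n) b 2^b≤x x<2^[n+1+b] with x ℚP.<? pow2 (ℤ.suc b)
  ... | yes x<2^[1+b] = b , 2^b≤x , x<2^[1+b]
  ... | no  x≮2^[1+b] = search n (ℤ.suc b) (ℚP.≮⇒≥ x≮2^[1+b])
                          (subst (λ c → x < pow2 c) (shift (+ n) b) x<2^[n+1+b])

kappa-≤ : ∀ {x k κ} → x < pow2 (k ℤ.- + 3) → pow2 (κ ℤ.- + 4) ≤ x → κ ℤ.≤ k
kappa-≤ {x} {k} {κ} x<2^[k-3] 2^[κ-4]≤x = begin
  κ                              ≡⟨ solve (κ ∷ []) ⟩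
  (+ 1 ℤ.+ (κ ℤ.- + 4)) ℤ.+ + 3  ≤⟨ ℤP.+-monoˡ-≤ (+ 3) (ℤP.i<j⇒suc[i]≤j κ-4<k-3) ⟩
  (k ℤ.- + 3) ℤ.+ + 3            ≡⟨ solve (k ∷ []) ⟩
  k                              ∎
  where
  open ℤP.≤-Reasoning
  κ-4<k-3 : κ ℤ.- + 4 ℤ.< k ℤ.- + 3
  κ-4<k-3 = pow2-cancel-< (ℚP.≤-<-trans 2^[κ-4]≤x x<2^[k-3])

kappa-bounded⇒< : ∀ {x ℓ} → (∀ κ → pow2 (κ ℤ.- + 4) ≤ x × x < pow2 (κ ℤ.- + 3) → κ ℤ.≤ ℓ) →
                  x < pow2 (ℓ ℤ.- + 3)
kappa-bounded⇒< {x} {ℓ} bounded = ℚP.≰⇒> λ 2^[ℓ-3]≤x → refute 2^[ℓ-3]≤x (pow2-bracket {x} {ℓ ℤ.- + 3} 2^[ℓ-3]≤x)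
  where
  refute : pow2 (ℓ ℤ.- + 3) ≤ x → ∃[ b ] pow2 b ≤ x × x < pow2 (ℤ.suc b) → ⊥
  refute 2^[ℓ-3]≤x (b , 2^b≤x , x<2^[1+b]) = ℤP.<⇒≱ ℓ<b+4 (bounded (b ℤ.+ + 4)
    ( subst (λ c → pow2 c ≤ x) b≡b+4-4 2^b≤x
    , subst (λ c → x < pow2 c) 1+b≡b+4-3 x<2^[1+b]))
    where
    b≡b+4-4 : b ≡ (b ℤ.+ + 4) ℤ.- + 4
    b≡b+4-4 = solve (b ∷ [])
    1+b≡b+4-3 : + 1 ℤ.+ b ≡ (b ℤ.+ + 4) ℤ.- + 3
    1+b≡b+4-3 = solve (b ∷ [])
    ℓ-3<1+b : ℓ ℤ.- + 3 ℤ.< ℤ.suc b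
    ℓ-3<1+b = pow2-cancel-< (ℚP.≤-<-trans 2^[ℓ-3]≤x x<2^[1+b])
    ℓ<b+4 : ℓ ℤ.< b ℤ.+ + 4
    ℓ<b+4 = begin-strict
      ℓ                              ≡⟨ solve (ℓ ∷ []) ⟩
      (ℓ ℤ.- + 3) ℤ.+ + 3            <⟨ ℤP.+-monoˡ-< (+ 3) ℓ-3<1+b ⟩
      (+ 1 ℤ.+ b) ℤ.+ + 3            ≡⟨ solve (b ∷ []) ⟩
      b ℤ.+ + 4                      ∎
      where open ℤP.≤-Reasoning

-- Finite sums

⌊⌋≡true⇒ : ∀ {P : Set} (P? : Dec P) → ⌊ P? ⌋ ≡ true → P
⌊⌋≡true⇒ (yes p) _ = p

⌊⌋≡true : ∀ {P : Set} (P? : Dec P) → P → ⌊ P? ⌋ ≡ true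
⌊⌋≡true (yes _) _ = refl
⌊⌋≡true (no ¬p) p = ⊥-elim (¬p p)

⌊⌋≡false : ∀ {P : Set} (P? : Dec P) → ¬ P → ⌊ P? ⌋ ≡ false
⌊⌋≡false (yes p) ¬p = ⊥-elim (¬p p)
⌊⌋≡false (no _)  _  = refl

⌊suc≟suc⌋ : ∀ {n} (i j : Fin n) → ⌊ suc i ≟ suc j ⌋ ≡ ⌊ i ≟ j ⌋
⌊suc≟suc⌋ i j = ⌊⌋-map′ _ _ (i ≟ j)

if-nonneg : ∀ b {x} → 0ℚ ≤ x → 0ℚ ≤ (if b then x else 0ℚ)
if-nonneg true  0≤x = 0≤x
if-nonneg false _   = ℚP.≤-refl

if-mono-≤ : ∀ b {x y} → (b ≡ true → x ≤ y) → (if b then x else 0ℚ) ≤ (if b then y else 0ℚ)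
if-mono-≤ true  x≤y = x≤y refl
if-mono-≤ false _   = ℚP.≤-refl

sumF≡sum : ∀ n (g : Fin n → ℚ) → sumF n g ≡ sum g
sumF≡sum zero    g = refl
sumF≡sum (suc n) g = cong (_+_ (g zero)) (sumF≡sum n (g ∘ suc))

sum-mono-≤ : ∀ {n} {g h : Fin n → ℚ} → (∀ i → g i ≤ h i) → sum g ≤ sum h
sum-mono-≤ {zero}  g≤h = ℚP.≤-refl
sum-mono-≤ {suc n} g≤h = ℚP.+-mono-≤ (g≤h zero) (sum-mono-≤ (g≤h ∘ suc))

sum-nonneg : ∀ {n} {g : Fin n → ℚ} → (∀ i → 0ℚ ≤ g i) → 0ℚ ≤ sum g
sum-nonneg {n} 0≤g = ℚP.≤-trans (ℚP.≤-reflexive (sym (sum-replicate-zero n))) (sum-mono-≤ 0≤g)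

≤-sum : ∀ {n} {g : Fin n → ℚ} → (∀ i → 0ℚ ≤ g i) → ∀ i → g i ≤ sum g
≤-sum {suc n} {g} 0≤g zero    = p≤p+q (sum-nonneg (0≤g ∘ suc))
≤-sum {suc n} {g} 0≤g (suc i) = ℚP.≤-trans (≤-sum (0≤g ∘ suc) i) (q≤p+q (0≤g zero))

sum-indicator : ∀ {n} (i : Fin n) (g : Fin n → ℚ) → sum (λ j → if ⌊ i ≟ j ⌋ then g j else 0ℚ) ≡ g i
sum-indicator {suc n} zero g = begin
  g zero + sum {n} (λ _ → 0ℚ) ≡⟨ cong (_+_ (g zero)) (sum-replicate-zero n) ⟩
  g zero + 0ℚ              ≡⟨ ℚP.+-identityʳ (g zero) ⟩
  g zero                   ∎
  where open ≡-Reasoning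
sum-indicator {suc n} (suc i) g = begin
  0ℚ + sum (λ j → if ⌊ suc i ≟ suc j ⌋ then g (suc j) else 0ℚ) ≡⟨ ℚP.+-identityˡ _ ⟩
  sum (λ j → if ⌊ suc i ≟ suc j ⌋ then g (suc j) else 0ℚ)      ≡⟨ sum-cong-≗ (λ j → cong (λ b → if b then g (suc j) else 0ℚ) (⌊suc≟suc⌋ i j)) ⟩
  sum (λ j → if ⌊ i ≟ j ⌋ then g (suc j) else 0ℚ)              ≡⟨ sum-indicator i (g ∘ suc) ⟩
  g (suc i)                                                    ∎
  where open ≡-Reasoning

sum-if-none : ∀ {n} {S : Fin n → Bool} {g : Fin n → ℚ} → (∀ j → S j ≡ false) →
              sum (λ j → if S j then g j else 0ℚ) ≡ 0ℚ
sum-if-none {n} {S} {g} S≡∅ =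
  trans (sum-cong-≗ (λ j → cong (λ b → if b then g j else 0ℚ) (S≡∅ j))) (sum-replicate-zero n)

sum-fibres : ∀ {m n} (τ : Fin m → Fin n) (g : Fin m → Fin n → ℚ) →
             sum (λ i → g i (τ i)) ≡ sum (λ j → sum (λ i → if ⌊ τ i ≟ j ⌋ then g i j else 0ℚ))
sum-fibres τ g = trans (sum-cong-≗ (λ i → sym (sum-indicator (τ i) (g i))))
                       (∑-comm (λ i j → if ⌊ τ i ≟ j ⌋ then g i j else 0ℚ))

countF-* : ∀ n (p : Fin n → Bool) x → ℕtoℚ (countF n p) * x ≡ sum (λ i → if p i then x else 0ℚ)
countF-* zero    p x = ℚP.*-zeroˡ x
countF-* (suc n) p x with p zero
... | true  = begin
  ℕtoℚ (suc c) * x         ≡⟨ cong (_* x) (ℕtoℚ-suc c) ⟩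
  (1ℚ + ℕtoℚ c) * x        ≡⟨ ℚP.*-distribʳ-+ x 1ℚ (ℕtoℚ c) ⟩
  1ℚ * x + ℕtoℚ c * x      ≡⟨ cong₂ _+_ (ℚP.*-identityˡ x) (countF-* n (p ∘ suc) x) ⟩
  x + sum (λ i → if p (suc i) then x else 0ℚ) ∎
  where
  open ≡-Reasoning
  c = countF n (p ∘ suc)
... | false = trans (countF-* n (p ∘ suc) x) (sym (ℚP.+-identityˡ _))

countF-cong : ∀ n {p q : Fin n → Bool} → (∀ i → p i ≡ q i) → countF n p ≡ countF n q
countF-cong zero    p≗q = refl
countF-cong (suc n) p≗q = cong₂ ℕ._+_ (cong (λ b → if b then 1 else 0) (p≗q zero)) (countF-cong n (p≗q ∘ suc))

countF-singleton : ∀ {n} (i : Fin n) → countF n (λ j → ⌊ i ≟ j ⌋) ≡ 1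
countF-singleton {suc n} zero    = cong suc (countF-false n)
  where
  countF-false : ∀ n → countF n (λ _ → false) ≡ 0
  countF-false zero    = refl
  countF-false (suc n) = countF-false n
countF-singleton {suc n} (suc i) = trans (countF-cong n (⌊suc≟suc⌋ i)) (countF-singleton i)

anyF⇒∃ : ∀ n (p : Fin n → Bool) → anyF n p ≡ true → ∃[ i ] p i ≡ true
anyF⇒∃ (suc n) p any with p zero in p0
... | true  = zero , p0
... | false = let (i , pi) = anyF⇒∃ n (p ∘ suc) any in suc i , pi

argmin : ∀ {n} (S : Fin n → Bool) (g : Fin n → ℚ) →
         (∀ j → S j ≡ false) ⊎ ∃[ j₀ ] S j₀ ≡ true × (∀ j → S j ≡ true → g j₀ ≤ g j)
argmin {zero}  S g = inj₁ λ ()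
argmin {suc n} S g with S zero in S0 | argmin (S ∘ suc) (g ∘ suc)
... | false | inj₁ none = inj₁ λ { zero → S0 ; (suc j) → none j }
... | false | inj₂ (j₀ , j₀∈S , min) =
  inj₂ (suc j₀ , j₀∈S , λ { zero 0∈S → contradiction (trans (sym S0) 0∈S) λ () ; (suc j) j∈S → min j j∈S })
... | true  | inj₁ none =
  inj₂ (zero , S0 , λ { zero _ → ℚP.≤-refl ; (suc j) j∈S → contradiction (trans (sym (none j)) j∈S) λ () })
... | true  | inj₂ (j₀ , j₀∈S , min) with ℚP.≤-total (g zero) (g (suc j₀))
...   | inj₁ g0≤ = inj₂ (zero , S0 , λ { zero _ → ℚP.≤-refl ; (suc j) j∈S → ℚP.≤-trans g0≤ (min j j∈S) })
...   | inj₂ ≤g0 = inj₂ (suc j₀ , j₀∈S , λ { zero _ → ≤g0 ; (suc j) j∈S → min j j∈S })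

-- Nice clusterings

module _ {I : Instance} (𝒞 : Clustering I) where
  open Instance I
  open Clustering 𝒞

  opening-cost-≤-critical : IsClustering I 𝒞 → (∀ i → 0ℚ ≤ f i) → ∀ i →
    (if openOf I 𝒞 i then f i else 0ℚ) ≤ sum (λ c → if ⌊ fac c ≟ i ⌋ then (if crit c then f i else 0ℚ) else 0ℚ)
  opening-cost-≤-critical (_ , critical) 0≤f i = bound (openOf I 𝒞 i) refl
    where
    term : Fin m → ℚ
    term c = if ⌊ fac c ≟ i ⌋ then (if crit c then f i else 0ℚ) else 0ℚ
    term-nonneg : ∀ c → 0ℚ ≤ term c
    term-nonneg c = if-nonneg ⌊ fac c ≟ i ⌋ (if-nonneg (crit c) (0≤f i))
    term-critical : ∀ {c*} → fac c* ≡ i → crit c* ≡ true → term c* ≡ f i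
    term-critical {c*} c*∈i c*-crit rewrite ⌊⌋≡true (fac c* ≟ i) c*∈i | c*-crit = refl
    bound : ∀ b → openOf I 𝒞 i ≡ b → (if b then f i else 0ℚ) ≤ sum term
    bound false _      = sum-nonneg term-nonneg
    bound true  isOpen with anyF⇒∃ m (λ c → ⌊ fac c ≟ i ⌋) isOpen
    ... | c , c∈i with critical c
    ...   | c* , c*∼c , c*-crit , _ = begin
      f i      ≡⟨ term-critical (trans c*∼c (⌊⌋≡true⇒ (fac c ≟ i) c∈i)) c*-crit ⟨
      term c*  ≤⟨ ≤-sum term-nonneg c* ⟩
      sum term ∎
      where open ℚP.≤-Reasoning

  solCost-≤-sum-cost : IsClustering I 𝒞 → (∀ i → 0ℚ ≤ f i) →
    solCost I (openOf I 𝒞) (assignOf I 𝒞) ≤ sum (λ c → cost I (clusterOf I 𝒞 c))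
  solCost-≤-sum-cost isClustering 0≤f = begin
    solCost I (openOf I 𝒞) (assignOf I 𝒞)
      ≡⟨ cong₂ _+_ (sumF≡sum nF opening) (sumF≡sum nD assigned) ⟩
    sum opening + sum assigned
      ≤⟨ ℚP.+-monoˡ-≤ (sum assigned) (sum-mono-≤ (opening-cost-≤-critical isClustering 0≤f)) ⟩
    sum (λ i → sum (λ c → if ⌊ fac c ≟ i ⌋ then (if crit c then f i else 0ℚ) else 0ℚ)) + sum assigned
      ≡⟨ cong₂ _+_ (sum-fibres fac (λ c i → if crit c then f i else 0ℚ))
                   (sym (sum-fibres clu (λ j c → d (fac c) j))) ⟨
    sum critical + sum (λ c → sum (served c))
      ≡⟨ ∑-distrib-+ critical (sum ∘ served) ⟨
    sum (λ c → critical c + sum (served c))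
      ≡⟨ sum-cong-≗ (λ c → cong (_+_ (critical c)) (sumF≡sum nD (served c))) ⟨
    sum (λ c → cost I (clusterOf I 𝒞 c)) ∎
    where
    open ℚP.≤-Reasoning
    opening  = λ i → if openOf I 𝒞 i then f i else 0ℚ
    assigned = λ j → d (fac (clu j)) j
    critical = λ c → if crit c then f (fac c) else 0ℚ
    served   = λ c j → if ⌊ clu j ≟ c ⌋ then d (fac c) j else 0ℚ

  sum-cost-≤-sum-pow2-level : (∀ c → AvgLt I (clusterOf I 𝒞 c) (pow2 (lev c))) →
    sum (λ c → cost I (clusterOf I 𝒞 c)) ≤ sum (λ j → pow2 (levelOf I 𝒞 j))
  sum-cost-≤-sum-pow2-level avg<2^level = begin
    sum (λ c → cost I (clusterOf I 𝒞 c))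
      ≤⟨ sum-mono-≤ (λ c → ℚP.<⇒≤ (avg<2^level c)) ⟩
    sum (λ c → ℕtoℚ (size I (clusterOf I 𝒞 c)) * pow2 (lev c))
      ≡⟨ sum-cong-≗ (λ c → countF-* nD (λ j → ⌊ clu j ≟ c ⌋) (pow2 (lev c))) ⟩
    sum (λ c → sum (λ j → if ⌊ clu j ≟ c ⌋ then pow2 (lev c) else 0ℚ))
      ≡⟨ sum-fibres clu (λ _ c → pow2 (lev c)) ⟨
    sum (λ j → pow2 (lev (clu j))) ∎
    where open ℚP.≤-Reasoning

  module _ (no-blocking : ∀ C k → ¬ Blocking I 𝒞 C k) where

    satellite-distance-≥ : ∀ {i j k c*} → fac c* ≡ i → crit c* ≡ true → lev c* ℤ.≤ k →
                           k ℤ.< levelOf I 𝒞 j → pow2 (k ℤ.- + 3) ≤ d i j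
    satellite-distance-≥ {i} {j} {k} {c*} c*∈i c*-crit c*≤k k<ℓj = ℚP.≮⇒≥ λ d<2^[k-3] →
      no-blocking (cluster i false (λ x → ⌊ j ≟ x ⌋)) k
        ( ((j , ⌊⌋≡true (j ≟ j) refl) , λ _ → countF-singleton j)
        , subst₂ _<_ (sym cost≡d) (sym size*≡) d<2^[k-3]
        , (λ x j≡x → subst (λ y → k ℤ.< levelOf I 𝒞 y × (∀ κ → IsKappa I i y κ → κ ℤ.≤ k))
                           (⌊⌋≡true⇒ (j ≟ x) j≡x)
                           (k<ℓj , λ κ isκ → kappa-≤ d<2^[k-3] (proj₁ isκ)))
        , (c* , c*∈i , c*-crit , c*≤k))
      where
      cost≡d : cost I (cluster i false (λ x → ⌊ j ≟ x ⌋)) ≡ d i j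
      cost≡d = trans (ℚP.+-identityˡ _) (trans (sumF≡sum nD _) (sum-indicator j (d i)))
      size*≡ : ℕtoℚ (size I (cluster i false (λ x → ⌊ j ≟ x ⌋))) * pow2 (k ℤ.- + 3) ≡ pow2 (k ℤ.- + 3)
      size*≡ = trans (cong (λ n → ℕtoℚ n * pow2 (k ℤ.- + 3)) (countF-singleton j)) (ℚP.*-identityˡ _)

    critical-cluster⇒opening-cost-≥ : ∀ {i k} (A : Fin nD → Bool) → 0ℚ ≤ f i →
      (∀ c → fac c ≡ i → k ℤ.≤ lev c) →
      (∀ j → A j ≡ true → k ℤ.< levelOf I 𝒞 j × d i j < pow2 (k ℤ.- + 4)) →
      ℕtoℚ (countF nD A) * pow2 (k ℤ.- + 4) ≤ f i
    critical-cluster⇒opening-cost-≥ {i} {k} A 0≤f k≤levels near with FinP.any? (λ j → A j Bool.≟ true)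
    ... | no A≡∅ = begin
      ℕtoℚ (countF nD A) * p             ≡⟨ countF-* nD A p ⟩
      sum (λ j → if A j then p else 0ℚ)  ≡⟨ sum-if-none (λ j → BoolP.¬-not (λ Aj → A≡∅ (j , Aj))) ⟩
      0ℚ                                 ≤⟨ 0≤f ⟩
      f i                                ∎
      where
      open ℚP.≤-Reasoning
      p = pow2 (k ℤ.- + 4)
    ... | yes (j , Aj) = ℚP.≮⇒≥ λ f<N*p → no-blocking (cluster i true A) k
      ( ((j , Aj) , λ ())
      , cost<N*2^[k-3] f<N*p
      , (λ x Ax → proj₁ (near x Ax)
                , λ κ isκ → kappa-≤ (ℚP.<-≤-trans (proj₂ (near x Ax)) 2^[k-4]≤2^[k-3]) (proj₁ isκ))
      , k≤levels)
      where
      N = ℕtoℚ (countF nD A)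
      p = pow2 (k ℤ.- + 4)
      D = λ x → if A x then d i x else 0ℚ
      2^[k-4]≤2^[k-3] : p ≤ pow2 (k ℤ.- + 3)
      2^[k-4]≤2^[k-3] = pow2-minus-antimono k (ℕP.n≤1+n 3)
      cost<N*2^[k-3] : f i < N * p → f i + sumF nD D < N * pow2 (k ℤ.- + 3)
      cost<N*2^[k-3] f<N*p = begin-strict
        f i + sumF nD D                     ≡⟨ cong (_+_ (f i)) (sumF≡sum nD D) ⟩
        f i + sum D                         ≤⟨ ℚP.+-monoʳ-≤ (f i) (sum-mono-≤ λ x →
                                                 if-mono-≤ (A x) (λ Ax → ℚP.<⇒≤ (proj₂ (near x Ax)))) ⟩
        f i + sum (λ x → if A x then p else 0ℚ) ≡⟨ cong (_+_ (f i)) (countF-* nD A p) ⟨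
        f i + N * p                         <⟨ ℚP.+-monoˡ-< (N * p) f<N*p ⟩
        N * p + N * p                       ≡⟨ ℚP.*-distribˡ-+ N p p ⟨
        N * (p + p)                         ≡⟨ cong (N *_) (pow2-minus-suc k 3) ⟩
        N * pow2 (k ℤ.- + 3)                ∎
        where open ℚP.≤-Reasoning

  module _ (valid : ValidInstance I) (isClustering : IsClustering I 𝒞) (nice : Nice I 𝒞) where
    private
      ℓ = levelOf I 𝒞
      critical-lowest = proj₁ (proj₂ nice)
      level-≥-kappa   = proj₁ (proj₂ (proj₂ nice))
      no-blocking     = proj₂ (proj₂ (proj₂ nice))
      triangle        = proj₂ (proj₂ valid)
      0≤d = λ i j → ℚP.<⇒≤ (proj₁ valid i j)
      0≤f = proj₁ (proj₂ valid)

    assigned-distance-< : ∀ j → d (fac (clu j)) j < pow2 (ℓ j ℤ.- + 3)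
    assigned-distance-< j = kappa-bounded⇒< (level-≥-kappa (clu j) j refl)

    lower-cluster⇒distance-≥ : ∀ {i j c} → fac c ≡ i → lev c ℤ.< ℓ j → pow2 (ℓ j ℤ.- + 4) ≤ d i j
    lower-cluster⇒distance-≥ {i} {j} {c} c∈i c<j with proj₂ isClustering c
    ... | c* , c*∼c , c*-crit , _ = subst (λ a → pow2 a ≤ d i j) pred[ℓj]-3≡ℓj-4
      (satellite-distance-≥ no-blocking (trans c*∼c c∈i) c*-crit
        (ℤP.≤-trans (critical-lowest c c* c*∼c c*-crit) (ℤP.i<j⇒i≤pred[j] c<j))
        (ℤP.i≤pred[j]⇒i<j ℤP.≤-refl))
      where
      pred[ℓj]-3≡ℓj-4 : ℤ.pred (ℓ j) ℤ.- + 3 ≡ ℓ j ℤ.- + 4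
      pred[ℓj]-3≡ℓj-4 = trans (ℤP.pred-+ (ℓ j) (ℤ.- + 3)) (sym (ℤP.minus-suc (ℓ j) 3))

    separated-levels⇒distance-sum-> : ∀ e {j j'} → ℓ j ℤ.+ + 2 ℤ.≤ ℓ j' →
                                      pow2 (ℓ j' ℤ.- + 5) < d e j + d e j'
    separated-levels⇒distance-sum-> e {j} {j'} j+2≤j' = +-cancelˡ-< {P} (begin-strict
      P + P                              ≡⟨ pow2-minus-suc (ℓ j') 4 ⟩
      pow2 (ℓ j' ℤ.- + 4)                ≤⟨ lower-cluster⇒distance-≥ refl (ℤP.<-≤-trans (i<i+[1+n] (ℓ j) 1) j+2≤j') ⟩
      d i j'                             ≤⟨ triangle i e j' j ⟩
      (d i j + d e j) + d e j'           <⟨ ℚP.+-monoˡ-< (d e j') (ℚP.+-monoˡ-< (d e j) near) ⟩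
      (P + d e j) + d e j'               ≡⟨ ℚP.+-assoc P (d e j) (d e j') ⟩
      P + (d e j + d e j')               ∎)
      where
      open ℚP.≤-Reasoning
      i = fac (clu j)
      P = pow2 (ℓ j' ℤ.- + 5)
      near : d i j < P
      near = ℚP.<-≤-trans (assigned-distance-< j) (pow2-mono-≤
        (subst (ℤ._≤ ℓ j' ℤ.- + 5) (ℤP.+-assoc (ℓ j) (+ 2) (ℤ.- + 5)) (ℤP.+-monoˡ-≤ (ℤ.- + 5) j+2≤j')))

    module _ (i : Fin nF) (S : Fin nD → Bool) {j₀ : Fin nD}
             (nearest : ∀ j → S j ≡ true → d i j₀ ≤ d i j) where
      private
        M = ℓ j₀
        -- the level at which the clients of S close to i would form a critical cluster
        k = M ℤ.- + 2
        D = λ j → if S j then d i j else 0ℚ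

        halve : ∀ {L j} → pow2 (L ℤ.- + 5) < d i j + d i j → pow2 (L ℤ.- + 6) < d i j
        halve {L} h = p+p<q+q⇒p<q (subst (_< _) (sym (pow2-minus-suc L 5)) h)

      below-nearest⇒distance-≥ : ∀ {j} → S j ≡ true → ℓ j ℤ.+ + 2 ℤ.≤ M → pow2 (ℓ j ℤ.- + 7) ≤ d i j
      below-nearest⇒distance-≥ {j} j∈S j+2≤M = ℚP.<⇒≤ (begin-strict
        pow2 (ℓ j ℤ.- + 7)  ≤⟨ pow2-mono-≤ (a+2≤b⇒a-7≤b-6 {ℓ j} j+2≤M) ⟩
        pow2 (M ℤ.- + 6)    <⟨ halve {M} (ℚP.<-≤-trans (separated-levels⇒distance-sum-> i j+2≤M)
                                                      (ℚP.+-monoʳ-≤ (d i j) (nearest j j∈S))) ⟩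
        d i j               ∎)
        where open ℚP.≤-Reasoning

      above-nearest⇒distance-≥ : ∀ {j} → S j ≡ true → M ℤ.+ + 2 ℤ.≤ ℓ j → pow2 (ℓ j ℤ.- + 7) ≤ d i j
      above-nearest⇒distance-≥ {j} j∈S M+2≤j = ℚP.<⇒≤ (begin-strict
        pow2 (ℓ j ℤ.- + 7)  ≤⟨ pow2-minus-antimono (ℓ j) (ℕP.n≤1+n 6) ⟩
        pow2 (ℓ j ℤ.- + 6)  <⟨ halve {ℓ j} (ℚP.<-≤-trans (separated-levels⇒distance-sum-> i M+2≤j)
                                                        (ℚP.+-monoˡ-≤ (d i j) (nearest j j∈S))) ⟩
        d i j               ∎)
        where open ℚP.≤-Reasoning

      low-cluster⇒distance-≥ : ∀ {c} → fac c ≡ i → lev c ℤ.< k →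
                               ∀ {j} → S j ≡ true → pow2 (ℓ j ℤ.- + 7) ≤ d i j
      low-cluster⇒distance-≥ c∈i c<k {j} j∈S with ℓ j ℤ.+ + 2 ℤ.≤? M
      ... | yes j+2≤M = below-nearest⇒distance-≥ j∈S j+2≤M
      ... | no  j+2≰M = ℚP.≤-trans (pow2-minus-antimono (ℓ j) (ℕP.m≤m+n 4 3))
                          (lower-cluster⇒distance-≥ c∈i (ℤP.<-trans c<k (a+2≰b⇒b-2<a {ℓ j} {M} j+2≰M)))

      Close? : ∀ j → Dec (S j ≡ true × k ℤ.< ℓ j × d i j < pow2 (k ℤ.- + 4))
      Close? j = (S j Bool.≟ true) ×-dec (k ℤ.<? ℓ j) ×-dec (d i j ℚP.<? pow2 (k ℤ.- + 4))

      close : Fin nD → Bool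
      close j = ⌊ Close? j ⌋

      client-charge : ∀ j → (if S j then pow2 (ℓ j ℤ.- + 7) else 0ℚ) ≤
                            (if S j then d i j else 0ℚ) + (if close j then pow2 (k ℤ.- + 4) else 0ℚ)
      client-charge j = by-membership (S j) refl
        where
        p = pow2 (k ℤ.- + 4)
        0≤charge : 0ℚ ≤ (if close j then p else 0ℚ)
        0≤charge = if-nonneg (close j) (ℚP.<⇒≤ (pow2-pos (k ℤ.- + 4)))
        far : pow2 (ℓ j ℤ.- + 7) ≤ d i j → pow2 (ℓ j ℤ.- + 7) ≤ d i j + (if close j then p else 0ℚ)
        far 2^[ℓj-7]≤d = ℚP.≤-trans 2^[ℓj-7]≤d (p≤p+q 0≤charge)
        in-band : S j ≡ true → k ℤ.< ℓ j → pow2 (ℓ j ℤ.- + 7) ≤ p → Dec (d i j < p) →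
                  pow2 (ℓ j ℤ.- + 7) ≤ d i j + (if close j then p else 0ℚ)
        in-band _   _   2^[ℓj-7]≤p (no d≮p)  = far (ℚP.≤-trans 2^[ℓj-7]≤p (ℚP.≮⇒≥ d≮p))
        in-band j∈S k<j 2^[ℓj-7]≤p (yes d<p) = begin
          pow2 (ℓ j ℤ.- + 7)                   ≤⟨ 2^[ℓj-7]≤p ⟩
          p                                    ≤⟨ q≤p+q (0≤d i j) ⟩
          d i j + p                            ≡⟨ cong (λ b → d i j + (if b then p else 0ℚ))
                                                   (⌊⌋≡true (Close? j) (j∈S , k<j , d<p)) ⟨
          d i j + (if close j then p else 0ℚ)  ∎
          where open ℚP.≤-Reasoning
        by-membership : ∀ b → S j ≡ b →
          (if b then pow2 (ℓ j ℤ.- + 7) else 0ℚ) ≤ (if b then d i j else 0ℚ) + (if close j then p else 0ℚ)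
        by-membership false _ = ℚP.≤-trans 0≤charge (q≤p+q {0ℚ} ℚP.≤-refl)
        by-membership true j∈S with ℓ j ℤ.+ + 2 ℤ.≤? M | M ℤ.+ + 2 ℤ.≤? ℓ j
        ... | yes j+2≤M | _         = far (below-nearest⇒distance-≥ j∈S j+2≤M)
        ... | no _      | yes M+2≤j = far (above-nearest⇒distance-≥ j∈S M+2≤j)
        ... | no j+2≰M  | no M+2≰j  = in-band j∈S (a+2≰b⇒b-2<a {ℓ j} {M} j+2≰M)
                                        (pow2-mono-≤ (a<b+2⇒a-7≤b-2-4 {ℓ j} {M} (ℤP.≰⇒> M+2≰j))) (d i j ℚP.<? p)

      star-shifted-bound : sum (λ j → if S j then pow2 (ℓ j ℤ.- + 7) else 0ℚ) ≤
                           f i + sum (λ j → if S j then d i j else 0ℚ)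
      star-shifted-bound with FinP.any? (λ c → (fac c ≟ i) ×-dec (lev c ℤ.<? k))
      ... | yes (c , c∈i , c<k) = begin
        sum (λ j → if S j then pow2 (ℓ j ℤ.- + 7) else 0ℚ) ≤⟨ sum-mono-≤ (λ j →
                                                               if-mono-≤ (S j) (low-cluster⇒distance-≥ c∈i c<k)) ⟩
        sum D                                             ≤⟨ q≤p+q (0≤f i) ⟩
        f i + sum D                                       ∎
        where open ℚP.≤-Reasoning
      ... | no ∄low = begin
        sum (λ j → if S j then pow2 (ℓ j ℤ.- + 7) else 0ℚ) ≤⟨ sum-mono-≤ client-charge ⟩
        sum (λ j → D j + C j)                             ≡⟨ ∑-distrib-+ D C ⟩
        sum D + sum C                                     ≡⟨ cong (_+_ (sum D)) (countF-* nD close p) ⟨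
        sum D + ℕtoℚ (countF nD close) * p                ≤⟨ ℚP.+-monoʳ-≤ (sum D)
                                                               (critical-cluster⇒opening-cost-≥ no-blocking close (0≤f i) k≤levels near) ⟩
        sum D + f i                                       ≡⟨ ℚP.+-comm (sum D) (f i) ⟩
        f i + sum D                                       ∎
        where
        open ℚP.≤-Reasoning
        p = pow2 (k ℤ.- + 4)
        C = λ j → if close j then p else 0ℚ
        k≤levels : ∀ c → fac c ≡ i → k ℤ.≤ lev c
        k≤levels c c∈i = ℤP.≮⇒≥ λ c<k → ∄low (c , c∈i , c<k)
        near : ∀ j → close j ≡ true → k ℤ.< ℓ j × d i j < p
        near j close-j = proj₂ (⌊⌋≡true⇒ (Close? j) close-j)

    star-bound : ∀ i (S : Fin nD → Bool) →
      sum (λ j → if S j then pow2 (ℓ j) else 0ℚ) ≤ pow2 (+ 7) * (f i + sum (λ j → if S j then d i j else 0ℚ))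
    star-bound i S with argmin S (d i)
    ... | inj₁ S≡∅ = begin
      sum (λ j → if S j then pow2 (ℓ j) else 0ℚ) ≡⟨ sum-if-none S≡∅ ⟩
      0ℚ                                         ≤⟨ *-nonneg (ℚP.<⇒≤ (pow2-pos (+ 7))) 0≤star-cost ⟩
      pow2 (+ 7) * (f i + sum D)                 ∎
      where
      open ℚP.≤-Reasoning
      D = λ j → if S j then d i j else 0ℚ
      0≤star-cost : 0ℚ ≤ f i + sum D
      0≤star-cost = ℚP.≤-trans (sum-nonneg (λ j → if-nonneg (S j) (0≤d i j))) (q≤p+q (0≤f i))
    ... | inj₂ (j₀ , _ , nearest) = begin
      sum (λ j → if S j then pow2 (ℓ j) else 0ℚ)             ≡⟨ sum-cong-≗ (λ j → scale (S j)) ⟩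
      sum (λ j → pow2 (+ 7) * shifted j)                      ≡⟨ *-distribˡ-sum (pow2 (+ 7)) shifted ⟨
      pow2 (+ 7) * sum shifted                                ≤⟨ ℚP.*-monoˡ-≤-nonNeg (pow2 (+ 7))
                                                                   (star-shifted-bound i S nearest) ⟩
      pow2 (+ 7) * (f i + sum (λ j → if S j then d i j else 0ℚ)) ∎
      where
      open ℚP.≤-Reasoning
      shifted = λ j → if S j then pow2 (ℓ j ℤ.- + 7) else 0ℚ
      scale : ∀ {j} b → (if b then pow2 (ℓ j) else 0ℚ) ≡ pow2 (+ 7) * (if b then pow2 (ℓ j ℤ.- + 7) else 0ℚ)
      scale {j} true  = pow2-split 7 (ℓ j)
      scale     false = sym (ℚP.*-zeroʳ (pow2 (+ 7)))

    sum-pow2-level-≤-solCost : ∀ op σ → IsSolution I op σ →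
                               sum (λ j → pow2 (ℓ j)) ≤ pow2 (+ 7) * solCost I op σ
    sum-pow2-level-≤-solCost op σ solution = begin
      sum (λ j → pow2 (ℓ j))                                           ≡⟨ sum-fibres σ (λ j _ → pow2 (ℓ j)) ⟩
      sum (λ i → sum (λ j → if ⌊ σ j ≟ i ⌋ then pow2 (ℓ j) else 0ℚ))  ≤⟨ sum-mono-≤ (λ i → fibre-bound i (op i) refl) ⟩
      sum (λ i → pow2 (+ 7) * (F i + Dσ i))                            ≡⟨ *-distribˡ-sum (pow2 (+ 7)) (λ i → F i + Dσ i) ⟨
      pow2 (+ 7) * sum (λ i → F i + Dσ i)                              ≡⟨ cong (pow2 (+ 7) *_) (∑-distrib-+ F Dσ) ⟩
      pow2 (+ 7) * (sum F + sum Dσ)                                    ≡⟨ cong (λ x → pow2 (+ 7) * (sum F + x))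
                                                                            (sum-fibres σ (λ j i → d i j)) ⟨
      pow2 (+ 7) * (sum F + sum (λ j → d (σ j) j))                     ≡⟨ cong (pow2 (+ 7) *_)
                                                                            (cong₂ _+_ (sumF≡sum nF F) (sumF≡sum nD (λ j → d (σ j) j))) ⟨
      pow2 (+ 7) * solCost I op σ                                      ∎
      where
      open ℚP.≤-Reasoning
      F : Fin nF → ℚ
      F i = if op i then f i else 0ℚ
      Dσ : Fin nF → ℚ
      Dσ i = sum (λ j → if ⌊ σ j ≟ i ⌋ then d i j else 0ℚ)
      fibre-bound : ∀ i b → op i ≡ b → sum (λ j → if ⌊ σ j ≟ i ⌋ then pow2 (ℓ j) else 0ℚ) ≤
                                       pow2 (+ 7) * ((if b then f i else 0ℚ) + Dσ i)
      fibre-bound i true  _      = star-bound i (λ j → ⌊ σ j ≟ i ⌋)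
      fibre-bound i false closed = begin
        sum (λ j → if ⌊ σ j ≟ i ⌋ then pow2 (ℓ j) else 0ℚ)  ≡⟨ sum-if-none (λ j → ⌊⌋≡false (σ j ≟ i) (unassigned j)) ⟩
        0ℚ                                                  ≤⟨ *-nonneg (ℚP.<⇒≤ (pow2-pos (+ 7)))
                                                                 (ℚP.≤-trans (sum-nonneg (λ j → if-nonneg ⌊ σ j ≟ i ⌋ (0≤d i j)))
                                                                             (q≤p+q ℚP.≤-refl)) ⟩
        pow2 (+ 7) * (0ℚ + Dσ i)                            ∎
        where
        unassigned : ∀ j → σ j ≢ i
        unassigned j σj≡i = contradiction (trans (sym closed) (subst (λ x → op x ≡ true) σj≡i (solution j))) λ ()

theorem2 : ∃ λ (α : ℚ) → ∀ (I : Instance) → ValidInstance I →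
    (𝒞 : Clustering I) → IsClustering I 𝒞 → Nice I 𝒞 →
    (op : Fin (Instance.nF I) → Bool) (σ : Fin (Instance.nD I) → Fin (Instance.nF I)) →
    IsSolution I op σ →
    solCost I (openOf I 𝒞) (assignOf I 𝒞) ≤ α * solCost I op σ
theorem2 = pow2 (+ 7) , λ I valid 𝒞 isClustering nice op σ solution → begin
  solCost I (openOf I 𝒞) (assignOf I 𝒞)  ≤⟨ solCost-≤-sum-cost 𝒞 isClustering (proj₁ (proj₂ valid)) ⟩
  sum (λ c → cost I (clusterOf I 𝒞 c))   ≤⟨ sum-cost-≤-sum-pow2-level 𝒞 (proj₁ nice) ⟩
  sum (λ j → pow2 (levelOf I 𝒞 j))       ≤⟨ sum-pow2-level-≤-solCost 𝒞 valid isClustering nice op σ solution ⟩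
  pow2 (+ 7) * solCost I op σ            ∎
  where open ℚP.≤-Reasoning
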